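{- Let $\Pi$ be the map on $\mathbb{N}=\{1,2,3,\dots\}$ produced by the following procedure: at step $1$ set $\Pi(1)=1$; for $m=2,3,\dots$ in turn, at step $m$, if $\Pi(m-\lfloor m/2\rfloor)$ has not been assigned earlier set $\Pi(m-\lfloor m/2\rfloor)=m$, otherwise set $\Pi(m+\lfloor m/2\rfloor)=m$. Let $\Pi_{\rm even}$ be produced by the modified procedure: at step $1$ set $\Pi_{\rm even}(1)=1$; for $m=2,3,\dots$ in turn, at step $m$, if $m$ is even or $\Pi_{\rm even}(m-\lfloor m/2\rfloor)$ has been assigned earlier, set $\Pi_{\rm even}(m+\lfloor m/2\rfloor)=m$, otherwise set $\Pi_{\rm even}(m-\lfloor m/2\rfloor)=m$. Then $\Pi_{\rm even}=\Pi$. -}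

module Defs where

open import Data.Nat using (ℕ; zero; suc; _+_; _*_; _∸_; _/_; _%_; _≡ᵇ_)
open import Data.Bool using (Bool; true; false; if_then_else_; _∨_)
open import Data.Maybe using (Maybe; just; nothing; is-just)

PMap : Set
PMap = ℕ → Maybe ℕ

empty : PMap
empty _ = nothing

assign : PMap → ℕ → ℕ → PMap
assign f p v q = if q ≡ᵇ p then just v else f q

assigned : PMap → ℕ → Bool
assigned f p = is-just (f p)

isEven : ℕ → Bool
isEven m = m % 2 ≡ᵇ 0

-- Step m of the procedure for Π.
-- (For m = 1 this sets Π(1) = 1, since 1 ∸ ⌊1/2⌋ = 1 is unassigned.)
stepΠ : ℕ → PMap → PMap
stepΠ m f =
  if assigned f (m ∸ m / 2)
  then assign f (m + m / 2) m
  else assign f (m ∸ m / 2) m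

-- Step m of the procedure for Π_even.
-- (For m = 1 this sets Π_even(1) = 1, since 1 is odd and position 1 is unassigned.)
stepΠeven : ℕ → PMap → PMap
stepΠeven m f =
  if isEven m ∨ assigned f (m ∸ m / 2)
  then assign f (m + m / 2) m
  else assign f (m ∸ m / 2) m

stateΠ : ℕ → PMap
stateΠ zero    = empty
stateΠ (suc n) = stepΠ (suc n) (stateΠ n)

stateΠeven : ℕ → PMap
stateΠeven zero    = empty
stateΠeven (suc n) = stepΠeven (suc n) (stateΠeven n)

-- The limiting maps. Position p can only be written at a step m with
-- m ∸ ⌊m/2⌋ = p or m + ⌊m/2⌋ = p, both of which force m ≤ 2p; hence the
-- value at p after step 2p is final.
Π : ℕ → Maybe ℕ
Π p = stateΠ (2 * p) p

Πeven : ℕ → Maybe ℕ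
Πeven p = stateΠeven (2 * p) p

module Submission where

-- The two procedures differ only at an even step m = 2k + 2,
-- where Π_even writes to the right position m + ⌊m/2⌋ unconditionally while
-- Π first checks whether the left position m ∸ ⌊m/2⌋ = k + 1 is free.  But
-- k + 1 is also the left position ⌈(2k+1)/2⌉ of the preceding odd step
-- m − 1 = 2k + 1, and after any step of Π its left position is assigned
-- (either it already was, or the step writes it).  Hence at every even step
-- Π finds its left position occupied and behaves exactly like Π_even.

open import Defs
open import Data.Nat using (ℕ; zero; suc; _+_; _*_; _∸_; _/_; ⌊_/2⌋; ⌈_/2⌉; _≡ᵇ_; s≤s; z≤n)
open import Data.Nat.Properties using (m+n∸m≡n; ⌊n/2⌋+⌈n/2⌉≡n; ≡⇒≡ᵇ)
open import Data.Nat.DivMod using (m/n≡1+[m∸n]/n; m≤n⇒[n∸m]%m≡n%m)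
open import Data.Bool using (true; false)
open import Data.Bool.Properties using (T-≡)
open import Function.Bundles using (Equivalence)
open import Relation.Binary.PropositionalEquality using (_≡_; refl; sym; trans; cong; subst; module ≡-Reasoning)

/2≡⌊/2⌋ : ∀ m → m / 2 ≡ ⌊ m /2⌋
/2≡⌊/2⌋ zero          = refl
/2≡⌊/2⌋ (suc zero)    = refl
/2≡⌊/2⌋ (suc (suc m)) = trans (m/n≡1+[m∸n]/n {suc (suc m)} (s≤s (s≤s z≤n))) (cong suc (/2≡⌊/2⌋ m))

left≡⌈/2⌉ : ∀ m → m ∸ m / 2 ≡ ⌈ m /2⌉
left≡⌈/2⌉ m = begin
  m ∸ m / 2                     ≡⟨ cong (m ∸_) (/2≡⌊/2⌋ m) ⟩
  m ∸ ⌊ m /2⌋                   ≡⟨ cong (_∸ ⌊ m /2⌋) (sym (⌊n/2⌋+⌈n/2⌉≡n m)) ⟩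
  (⌊ m /2⌋ + ⌈ m /2⌉) ∸ ⌊ m /2⌋ ≡⟨ m+n∸m≡n ⌊ m /2⌋ ⌈ m /2⌉ ⟩
  ⌈ m /2⌉                       ∎
  where open ≡-Reasoning

isEven-+2 : ∀ m → isEven (suc (suc m)) ≡ isEven m
isEven-+2 m = cong (_≡ᵇ 0) (m≤n⇒[n∸m]%m≡n%m {n = suc (suc m)} (s≤s (s≤s z≤n)))

even⇒⌈/2⌉≡⌈pred/2⌉ : ∀ n → isEven (suc n) ≡ true → ⌈ suc n /2⌉ ≡ ⌈ n /2⌉
even⇒⌈/2⌉≡⌈pred/2⌉ zero ()
even⇒⌈/2⌉≡⌈pred/2⌉ (suc zero) _ = refl
even⇒⌈/2⌉≡⌈pred/2⌉ (suc (suc n)) even =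
  cong suc (even⇒⌈/2⌉≡⌈pred/2⌉ n (trans (sym (isEven-+2 (suc n))) even))

even⇒same-left : ∀ n → isEven (suc n) ≡ true → suc n ∸ suc n / 2 ≡ n ∸ n / 2
even⇒same-left n even = begin
  suc n ∸ suc n / 2 ≡⟨ left≡⌈/2⌉ (suc n) ⟩
  ⌈ suc n /2⌉       ≡⟨ even⇒⌈/2⌉≡⌈pred/2⌉ n even ⟩
  ⌈ n /2⌉           ≡⟨ sym (left≡⌈/2⌉ n) ⟩
  n ∸ n / 2         ∎
  where open ≡-Reasoning

assign-hit : ∀ f p v → assigned (assign f p v) p ≡ true
assign-hit f p v rewrite Equivalence.to T-≡ (≡⇒≡ᵇ p p refl) = refl

assign-keeps : ∀ f p v q → assigned f q ≡ true → assigned (assign f p v) q ≡ true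
assign-keeps f p v q assigned-q with q ≡ᵇ p
... | true  = refl
... | false = assigned-q

stepΠ-fills-left : ∀ m f → assigned (stepΠ m f) (m ∸ m / 2) ≡ true
stepΠ-fills-left m f with assigned f (m ∸ m / 2) in left-assigned
... | true  = assign-keeps f (m + m / 2) m (m ∸ m / 2) left-assigned
... | false = assign-hit f (m ∸ m / 2) m

stepΠeven≡stepΠ : ∀ m f → (isEven m ≡ true → assigned f (m ∸ m / 2) ≡ true) →
                  stepΠeven m f ≡ stepΠ m f
stepΠeven≡stepΠ m f even⇒filled with isEven m | assigned f (m ∸ m / 2)
... | false | _     = refl
... | true  | true  = refl
... | true  | false with even⇒filled refl
...   | ()

-- Before every even step n + 1 of Π, its left position is already assigned,
-- namely by the preceding (odd) step n, which shares that left position.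
even-step-finds-left-filled : ∀ n → isEven (suc n) ≡ true →
                              assigned (stateΠ n) (suc n ∸ suc n / 2) ≡ true
even-step-finds-left-filled zero ()
even-step-finds-left-filled (suc n) even =
  subst (λ p → assigned (stateΠ (suc n)) p ≡ true)
        (sym (even⇒same-left (suc n) even))
        (stepΠ-fills-left (suc n) (stateΠ n))

stateΠeven≡stateΠ : ∀ n → stateΠeven n ≡ stateΠ n
stateΠeven≡stateΠ zero    = refl
stateΠeven≡stateΠ (suc n) = begin
  stepΠeven (suc n) (stateΠeven n) ≡⟨ cong (stepΠeven (suc n)) (stateΠeven≡stateΠ n) ⟩
  stepΠeven (suc n) (stateΠ n)     ≡⟨ stepΠeven≡stepΠ (suc n) (stateΠ n) (even-step-finds-left-filled n) ⟩
  stepΠ (suc n) (stateΠ n)         ∎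
  where open ≡-Reasoning

proposition3 : (p : ℕ) → Πeven p ≡ Π p
proposition3 p = cong (λ state → state p) (stateΠeven≡stateΠ (2 * p))
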